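{- Let $\delta,C,M$ be integers with $3\le\delta<\infty$, $2\delta+2\le C\le3\delta+1$ and $\lceil\delta/2\rceil\le M\le\frac{C-\delta-1}{2}$, and let $\oplus$ be the magic operation on $\{1,\dots,\delta\}$ with these parameters. Let $x_1,\dots,x_k$ and $d_1,\dots,d_n$ be integers (with $k+n\ge1$) such that $1\le x_i<M$ and $M<d_i\le\delta$ for every $i$, and put $S=x_1\oplus\dots\oplus x_k\oplus d_1\oplus\dots\oplus d_n$. Then one of the following happens: 1. $S=M$; 2. $S<M$, $n$ is even and $S=\frac n2(C-1)+\sum_{i=1}^kx_i-\sum_{i=1}^nd_i$; 3. $S>M$, $n$ is odd and $S=\sum_{i=1}^nd_i-\frac{n-1}{2}(C-1)-\sum_{i=1}^kx_i$.
   Context: For integers $\delta,C,M$ as in the claim, the magic operation $\oplus:\{1,\dots,\delta\}^2\to\{1,\dots,\delta\}$ is defined by: $x\oplus y=|x-y|$ if $|x-y|>M$; otherwise $x\oplus y=\min(x+y,\,C-1-x-y)$ if this minimum is less than $M$; and $x\oplus y=M$ otherwise. This operation is commutative and associative. -}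

module Defs where

open import Data.Integer using (ℤ; +_; _+_; _-_; _*_; ∣_∣; _<_; _≤_; _<?_)
open import Data.Integer.Base using (_⊓_)
open import Data.List using (List; []; _∷_; _++_; foldl; sum)
open import Data.Bool using (if_then_else_)
open import Relation.Nullary.Decidable using (⌊_⌋)

-- The magic operation with parameters C and M (δ only enters through
-- the domain {1,…,δ}, which is imposed as hypotheses in the statement).
-- x ⊕ y = |x-y|                     if |x-y| > M
--       = min(x+y, C-1-x-y)         if that minimum is < M
--       = M                         otherwise
magic : (C M : ℤ) → ℤ → ℤ → ℤ
magic C M x y =
  if ⌊ M <? (+ ∣ x - y ∣) ⌋ then + ∣ x - y ∣
  else (if ⌊ ((x + y) ⊓ (C - + 1 - x - y)) <? M ⌋
        then (x + y) ⊓ (C - + 1 - x - y)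
        else M)

-- Iterated magic operation over a nonempty list a ∷ as, i.e.
-- a ⊕ a₁ ⊕ … ⊕ aₘ (bracketed to the left; ⊕ is associative).
magicFold : (C M : ℤ) → ℤ → List ℤ → ℤ
magicFold C M a as = foldl (magic C M) a as

sumℤ : List ℤ → ℤ
sumℤ [] = + 0
sumℤ (x ∷ xs) = x + sumℤ xs

module Submission where

-- We read the sum from left to right and show that every partial
-- result has one of these three shapes (with the bounds 1 ≤ S < M resp.
-- M < S ≤ δ).  M is absorbing for the entries at hand; a small entry keeps
-- the parity of n and moves a low S up by x (or to M) and a high S down by x
-- (or to M); a big entry flips the parity, reflecting a low S to d - S and a
-- high S to C - 1 - S - d (or sending it to M).

open import Defs
open import Data.Nat using (ℕ; suc; z≤n) renaming (_+_ to _+ℕ_)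
import Data.Nat.Properties as ℕ
open import Data.Integer
  using (ℤ; +_; 0ℤ; +≤+; _+_; _-_; _*_; ∣_∣; _<_; _≤_; _<?_; _⊓_)
open import Data.Integer.Properties
  using (≤-refl; ≤-reflexive; ≤-trans; ≤-total; <⇒≤; <⇒≱; ≮⇒≥; +-mono-≤; +-identityʳ; +-identityˡ;
         +-assoc; +-comm; i≤j⇒0≤j-i; 0≤i-j⇒j≤i; i<j⇒suc[i]≤j;
         ∣-∣-≤; ∣i-j∣≡∣j-i∣; ⊓-glb; i≤j⇒i⊓j≡i; i≥j⇒i⊓j≡j; *-cancelˡ-≤-pos)
open import Data.Integer.Tactic.RingSolver using (solve; solve-∀)
open import Data.List using (List; []; _∷_; _++_; length; foldl)
open import Data.List.Properties using (foldl-++)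
open import Data.List.Relation.Unary.All as All using (All)
open import Data.Product using (Σ; _×_; _,_)
open import Data.Sum using (_⊎_; inj₁; inj₂)
open import Relation.Binary.PropositionalEquality
  using (_≡_; refl; sym; trans; cong; subst; subst₂)
open import Relation.Nullary using (yes; no; contradiction)

-- Linear arithmetic by certificate: a ≤ b holds once b - a is written, up
-- to ring normalisation (done by `solve`), as a sum of non-negative terms.
≤-by : ∀ {e a b} → 0ℤ ≤ e → e ≡ b - a → a ≤ b
≤-by 0≤e refl = 0≤i-j⇒j≤i 0≤e

gap : ∀ {p q} → p ≤ q → 0ℤ ≤ q - p
gap = i≤j⇒0≤j-i

gap< : ∀ {p q} → p < q → 0ℤ ≤ q - (+ 1 + p)
gap< p<q = i≤j⇒0≤j-i (i<j⇒suc[i]≤j p<q)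

lit : ∀ n → 0ℤ ≤ + n
lit n = +≤+ z≤n

infixr 5 _⊞_
_⊞_ : ∀ {p q} → 0ℤ ≤ p → 0ℤ ≤ q → 0ℤ ≤ p + q
_⊞_ = +-mono-≤

dist-flip : ∀ {x y} → y ≤ x → + ∣ x - y ∣ ≡ x - y
dist-flip {x} {y} y≤x = trans (cong +_ (∣i-j∣≡∣j-i∣ x y)) (∣-∣-≤ y≤x)

spread : ∀ {a b u v} → a ≤ u → v ≤ b → v - u ≤ b - a
spread {a} {b} {u} {v} a≤u v≤b = ≤-by (gap v≤b ⊞ gap a≤u) (solve (a ∷ b ∷ u ∷ v ∷ []))

dist-≤ : ∀ {a b c x y} → a ≤ x → x ≤ b → a ≤ y → y ≤ b → b - a ≤ c →
         + ∣ x - y ∣ ≤ c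
dist-≤ {x = x} {y} a≤x x≤b a≤y y≤b width with ≤-total x y
... | inj₁ x≤y = ≤-trans (≤-reflexive (∣-∣-≤ x≤y)) (≤-trans (spread a≤x y≤b) width)
... | inj₂ y≤x = ≤-trans (≤-reflexive (dist-flip y≤x)) (≤-trans (spread a≤y x≤b) width)

module Magic (C M : ℤ) where

  infixl 6 _⊕_
  _⊕_ : ℤ → ℤ → ℤ
  _⊕_ = magic C M

  ⊕-far : ∀ {x y} → M < + ∣ x - y ∣ → x ⊕ y ≡ + ∣ x - y ∣
  ⊕-far {x} {y} far with M <? + ∣ x - y ∣
  ... | yes _   = refl
  ... | no ¬far = contradiction far ¬far

  ⊕-near : ∀ {x y} → + ∣ x - y ∣ ≤ M → (x + y) ⊓ (C - + 1 - x - y) < M →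
           x ⊕ y ≡ (x + y) ⊓ (C - + 1 - x - y)
  ⊕-near {x} {y} near low with M <? + ∣ x - y ∣
  ... | yes far = contradiction near (<⇒≱ far)
  ... | no _ with (x + y) ⊓ (C - + 1 - x - y) <? M
  ...   | yes _    = refl
  ...   | no ¬low  = contradiction low ¬low

  ⊕-absorb : ∀ {x y} → + ∣ x - y ∣ ≤ M → M ≤ x + y → M ≤ C - + 1 - x - y →
             x ⊕ y ≡ M
  ⊕-absorb {x} {y} near M≤s M≤s' with M <? + ∣ x - y ∣
  ... | yes far = contradiction near (<⇒≱ far)
  ... | no _ with (x + y) ⊓ (C - + 1 - x - y) <? M
  ...   | yes low = contradiction (⊓-glb M≤s M≤s') (<⇒≱ low)
  ...   | no _    = refl

  cosum-comm : ∀ x y → C - + 1 - x - y ≡ C - + 1 - y - x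
  cosum-comm x y = solve (C ∷ x ∷ y ∷ [])

  ⊕-comm : ∀ x y → x ⊕ y ≡ y ⊕ x
  ⊕-comm x y rewrite ∣i-j∣≡∣j-i∣ x y | +-comm x y | cosum-comm x y = refl

  ⊕-sum : ∀ {x y} → + ∣ x - y ∣ ≤ M → M ≤ C - + 1 - x - y →
          (x + y < M × x ⊕ y ≡ x + y) ⊎ x ⊕ y ≡ M
  ⊕-sum {x} {y} near M≤s' with x + y <? M
  ... | yes s<M = inj₁ (s<M , trans (⊕-near {x} {y} near (subst (_< M) (sym min≡) s<M)) min≡)
    where
    min≡ : (x + y) ⊓ (C - + 1 - x - y) ≡ x + y
    min≡ = i≤j⇒i⊓j≡i (≤-trans (<⇒≤ s<M) M≤s')
  ... | no s≮M  = inj₂ (⊕-absorb near (≮⇒≥ s≮M) M≤s')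

  ⊕-cosum : ∀ {x y} → + ∣ x - y ∣ ≤ M → M ≤ x + y →
            (C - + 1 - x - y < M × x ⊕ y ≡ C - + 1 - x - y) ⊎ x ⊕ y ≡ M
  ⊕-cosum {x} {y} near M≤s with C - + 1 - x - y <? M
  ... | yes s'<M = inj₁ (s'<M , trans (⊕-near {x} {y} near (subst (_< M) (sym min≡) s'<M)) min≡)
    where
    min≡ : (x + y) ⊓ (C - + 1 - x - y) ≡ C - + 1 - x - y
    min≡ = i≥j⇒i⊓j≡j (≤-trans (<⇒≤ s'<M) M≤s)
  ... | no s'≮M  = inj₂ (⊕-absorb near M≤s (≮⇒≥ s'≮M))

  ⊕-diff : ∀ {x y} → y ≤ x → M ≤ x + y → M ≤ C - + 1 - x - y →
           (M < x - y × x ⊕ y ≡ x - y) ⊎ x ⊕ y ≡ M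
  ⊕-diff {x} {y} y≤x M≤s M≤s' with M <? x - y
  ... | yes far = inj₁ (far , trans (⊕-far {x} {y} (subst (M <_) (sym (dist-flip y≤x)) far)) (dist-flip y≤x))
  ... | no ¬far = inj₂ (⊕-absorb {x} {y} (subst (_≤ M) (sym (dist-flip y≤x)) (≮⇒≥ ¬far)) M≤s M≤s')

low-plus-small : ∀ k C sx sd x →
  (k * (C - + 1) + sx - sd) + x ≡ k * (C - + 1) + (sx + x) - sd
low-plus-small = solve-∀

high-minus-small : ∀ k C sx sd x →
  (sd - k * (C - + 1) - sx) - x ≡ sd - k * (C - + 1) - (sx + x)
high-minus-small = solve-∀

low-to-high : ∀ k C sx sd d →
  d - (k * (C - + 1) + sx - sd) ≡ (sd + d) - k * (C - + 1) - sx
low-to-high = solve-∀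

high-to-low : ∀ k C sx sd d →
  C - + 1 - (sd - k * (C - + 1) - sx) - d ≡ (+ 1 + k) * (C - + 1) + sx - (sd + d)
high-to-low = solve-∀

start-low : ∀ C x → x ≡ + 0 * (C - + 1) + x - + 0
start-low = solve-∀

start-high : ∀ C d → d ≡ d - + 0 * (C - + 1) - + 0
start-high = solve-∀

module Proof (δ C M : ℤ) (δ≥3 : + 3 ≤ δ)
    (C-lower : (+ 2) * δ + + 2 ≤ C) (C-upper : C ≤ (+ 3) * δ + + 1)
    (M-lower : δ ≤ (+ 2) * M) (M-upper : (+ 2) * M ≤ C - δ - + 1) where

  open Magic C M

  0≤M : 0ℤ ≤ M
  0≤M = *-cancelˡ-≤-pos 0ℤ M (+ 2)
    (≤-by (gap M-lower ⊞ gap δ≥3 ⊞ lit 3) (solve (δ ∷ M ∷ [])))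

  M≤δ : M ≤ δ
  M≤δ = *-cancelˡ-≤-pos M δ (+ 2)
    (≤-by (gap M-upper ⊞ gap C-upper) (solve (C ∷ δ ∷ M ∷ [])))

  -- Any two entries of [0, M], and any two of [M, δ], are within M of each
  -- other; this keeps ⊕ out of its |x - y| branch.
  near-low : ∀ {u v} → 0ℤ ≤ u → u ≤ M → 0ℤ ≤ v → v ≤ M → + ∣ u - v ∣ ≤ M
  near-low 0≤u u≤M 0≤v v≤M =
    dist-≤ 0≤u u≤M 0≤v v≤M (≤-by (lit 0) (solve (M ∷ [])))

  near-high : ∀ {u v} → M ≤ u → u ≤ δ → M ≤ v → v ≤ δ → + ∣ u - v ∣ ≤ M
  near-high M≤u u≤δ M≤v v≤δ =
    dist-≤ M≤u u≤δ M≤v v≤δ (≤-by (gap M-lower) (solve (δ ∷ M ∷ [])))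

  Small Big : ℤ → Set
  Small x = + 1 ≤ x × x < M
  Big d = M < d × d ≤ δ

  data Shape (S sx sd : ℤ) (n : ℕ) : Set where
    middle : S ≡ M → Shape S sx sd n
    low    : + 1 ≤ S → S < M → (m : ℕ) → n ≡ m +ℕ m →
             S ≡ (+ m) * (C - + 1) + sx - sd → Shape S sx sd n
    high   : M < S → S ≤ δ → (m : ℕ) → n ≡ suc (m +ℕ m) →
             S ≡ sd - (+ m) * (C - + 1) - sx → Shape S sx sd n

  settle : ∀ {P : Set} {r v sx sd n} → (P × r ≡ v) ⊎ r ≡ M →
           (P → Shape v sx sd n) → Shape r sx sd n
  settle (inj₁ (p , refl)) shape = shape p
  settle (inj₂ r≡M)        _     = middle r≡M

  step-small : ∀ {S sx sd n x} → Shape S sx sd n → Small x →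
               Shape (S ⊕ x) (sx + x) sd n
  step-small {x = x} (middle refl) (x≥1 , x<M) = middle (⊕-absorb {M} {x}
    (near-low 0≤M ≤-refl (≤-trans (lit 1) x≥1) (<⇒≤ x<M))
    (≤-by (gap x≥1 ⊞ lit 1) (solve (M ∷ x ∷ [])))
    (≤-by (gap M-upper ⊞ gap M≤δ ⊞ gap< x<M ⊞ lit 1) (solve (C ∷ δ ∷ M ∷ x ∷ []))))
  step-small {S} {sx} {sd} {x = x} (low S≥1 S<M m n≡ S≡) (x≥1 , x<M) =
    settle (⊕-sum {S} {x}
             (near-low (≤-trans (lit 1) S≥1) (<⇒≤ S<M) (≤-trans (lit 1) x≥1) (<⇒≤ x<M))
             (≤-by (gap M-upper ⊞ gap M≤δ ⊞ gap< S<M ⊞ gap< x<M ⊞ lit 2)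
                   (solve (C ∷ δ ∷ M ∷ S ∷ x ∷ []))))
      λ S+x<M → low (≤-by (gap S≥1 ⊞ gap x≥1 ⊞ lit 1) (solve (S ∷ x ∷ []))) S+x<M m n≡
                    (trans (cong (_+ x) S≡) (low-plus-small (+ m) C sx sd x))
  step-small {S} {sx} {sd} {x = x} (high M<S S≤δ m n≡ S≡) (x≥1 , x<M) =
    settle (⊕-diff {S} {x} (≤-trans (<⇒≤ x<M) (<⇒≤ M<S))
             (≤-by (gap< M<S ⊞ gap x≥1 ⊞ lit 2) (solve (M ∷ S ∷ x ∷ [])))
             (≤-by (gap M-upper ⊞ gap S≤δ ⊞ gap< x<M ⊞ lit 1)
                   (solve (C ∷ δ ∷ M ∷ S ∷ x ∷ []))))
      λ M<S-x → high M<S-x (≤-by (gap S≤δ ⊞ gap x≥1 ⊞ lit 1) (solve (δ ∷ S ∷ x ∷ []))) m n≡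
                     (trans (cong (_- x) S≡) (high-minus-small (+ m) C sx sd x))

  step-big : ∀ {S sx sd n d} → Shape S sx sd n → Big d →
             Shape (S ⊕ d) sx (sd + d) (suc n)
  step-big {d = d} (middle refl) (M<d , d≤δ) = middle (⊕-absorb {M} {d}
    (near-high ≤-refl M≤δ (<⇒≤ M<d) d≤δ)
    (≤-by (gap< M<d ⊞ 0≤M ⊞ lit 1) (solve (M ∷ d ∷ [])))
    (≤-by (gap M-upper ⊞ gap d≤δ) (solve (C ∷ δ ∷ M ∷ d ∷ []))))
  step-big {S} {sx} {sd} {n} {d} (low S≥1 S<M m n≡ S≡) (M<d , d≤δ) =
    subst (λ r → Shape r sx (sd + d) (suc n)) (⊕-comm d S)
      (settle (⊕-diff {d} {S} (≤-trans (<⇒≤ S<M) (<⇒≤ M<d))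
                (≤-by (gap< M<d ⊞ gap S≥1 ⊞ lit 2) (solve (M ∷ S ∷ d ∷ [])))
                (≤-by (gap M-upper ⊞ gap d≤δ ⊞ gap< S<M ⊞ lit 1)
                      (solve (C ∷ δ ∷ M ∷ S ∷ d ∷ []))))
         λ M<d-S → high M<d-S (≤-by (gap d≤δ ⊞ gap S≥1 ⊞ lit 1) (solve (δ ∷ S ∷ d ∷ [])))
                        m (cong suc n≡)
                        (trans (cong (d -_) S≡) (low-to-high (+ m) C sx sd d)))
  step-big {S} {sx} {sd} {d = d} (high M<S S≤δ m n≡ S≡) (M<d , d≤δ) =
    settle (⊕-cosum {S} {d} (near-high (<⇒≤ M<S) S≤δ (<⇒≤ M<d) d≤δ)
             (≤-by (gap< M<S ⊞ gap< M<d ⊞ 0≤M ⊞ lit 2) (solve (M ∷ S ∷ d ∷ []))))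
      λ co<M → low (≤-by (gap C-lower ⊞ gap S≤δ ⊞ gap d≤δ) (solve (C ∷ δ ∷ S ∷ d ∷ [])))
                   co<M (suc m) (cong suc (trans n≡ (sym (ℕ.+-suc m m))))
                   (trans (cong (λ t → C - + 1 - t - d) S≡) (high-to-low (+ m) C sx sd d))

  fold-small : ∀ {S sx sd n} xs → Shape S sx sd n → All Small xs →
               Shape (foldl _⊕_ S xs) (sx + sumℤ xs) sd n
  fold-small {S} {sx} {sd} {n} [] shape All.[] =
    subst (λ t → Shape S t sd n) (sym (+-identityʳ sx)) shape
  fold-small {S} {sx} {sd} {n} (x ∷ xs) shape (small All.∷ smalls) =
    subst (λ t → Shape (foldl _⊕_ (S ⊕ x) xs) t sd n) (+-assoc sx x (sumℤ xs))
      (fold-small xs (step-small shape small) smalls)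

  fold-big : ∀ {S sx sd n} ds → Shape S sx sd n → All Big ds →
             Shape (foldl _⊕_ S ds) sx (sd + sumℤ ds) (n +ℕ length ds)
  fold-big {S} {sx} {sd} {n} [] shape All.[] =
    subst₂ (Shape S sx) (sym (+-identityʳ sd)) (sym (ℕ.+-identityʳ n)) shape
  fold-big {S} {sx} {sd} {n} (d ∷ ds) shape (big All.∷ bigs) =
    subst₂ (Shape (foldl _⊕_ (S ⊕ d) ds) sx) (+-assoc sd d (sumℤ ds)) (sym (ℕ.+-suc n (length ds)))
      (fold-big ds (step-big shape big) bigs)

  start-small : ∀ {x} → Small x → Shape x x 0ℤ 0
  start-small {x} (x≥1 , x<M) = low x≥1 x<M 0 refl (start-low C x)

  start-big : ∀ {d} → Big d → Shape d 0ℤ d 1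
  start-big {d} (M<d , d≤δ) = high M<d d≤δ 0 refl (start-high C d)

  shape-of-sum : ∀ xs ds → All Small xs → All Big ds → ∀ {a rest} →
                 xs ++ ds ≡ a ∷ rest →
                 Shape (foldl _⊕_ a rest) (sumℤ xs) (sumℤ ds) (length ds)
  shape-of-sum [] (d ∷ ds) All.[] (big All.∷ bigs) refl =
    fold-big ds (start-big big) bigs
  shape-of-sum (x ∷ xs) ds (small All.∷ smalls) bigs refl =
    subst₂ (λ r t → Shape r (x + sumℤ xs) t (length ds))
      (sym (foldl-++ _⊕_ x xs ds)) (+-identityˡ (sumℤ ds))
      (fold-big ds (fold-small xs (start-small small) smalls) bigs)

  Alternatives : ℤ → List ℤ → List ℤ → Set
  Alternatives S xs ds =
    S ≡ M
    ⊎ (S < M × Σ ℕ (λ m → length ds ≡ m +ℕ m ×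
         S ≡ (+ m) * (C - + 1) + sumℤ xs - sumℤ ds))
    ⊎ (M < S × Σ ℕ (λ m → length ds ≡ suc (m +ℕ m) ×
         S ≡ sumℤ ds - (+ m) * (C - + 1) - sumℤ xs))

  alternatives : ∀ {S} xs ds → Shape S (sumℤ xs) (sumℤ ds) (length ds) →
                 Alternatives S xs ds
  alternatives xs ds (middle S≡M)           = inj₁ S≡M
  alternatives xs ds (low _ S<M m n≡ S≡)    = inj₂ (inj₁ (S<M , m , n≡ , S≡))
  alternatives xs ds (high M<S _ m n≡ S≡)   = inj₂ (inj₂ (M<S , m , n≡ , S≡))

proposition6p4 : (δ C M : ℤ) → + 3 ≤ δ →
  (+ 2) * δ + + 2 ≤ C → C ≤ (+ 3) * δ + + 1 →
  δ ≤ (+ 2) * M → (+ 2) * M ≤ C - δ - + 1 →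
  (xs ds : List ℤ) →
  All (λ x → + 1 ≤ x × x < M) xs →
  All (λ d → M < d × d ≤ δ) ds →
  (a : ℤ) (rest : List ℤ) → xs ++ ds ≡ a ∷ rest →
  let S = magicFold C M a rest
      n = length ds
  in S ≡ M
     ⊎ (S < M × Σ ℕ (λ m → n ≡ m Data.Nat.+ m ×
          S ≡ (+ m) * (C - + 1) + sumℤ xs - sumℤ ds))
     ⊎ (M < S × Σ ℕ (λ m → n ≡ Data.Nat.suc (m Data.Nat.+ m) ×
          S ≡ sumℤ ds - (+ m) * (C - + 1) - sumℤ xs))
proposition6p4 δ C M δ≥3 C-lower C-upper M-lower M-upper xs ds smalls bigs a rest split =
  alternatives xs ds (shape-of-sum xs ds smalls bigs split)
  where open Proof δ C M δ≥3 C-lower C-upper M-lower M-upper
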